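{- Let $G$ be a finite abelian group and $r\ge 1$ an integer. If $\eta(G)\le D(G)+\exp(G)$, then $\eta_r(G)\le D(G)+r\exp(G)$.
   Context: Groups are written additively; $\exp(G)$ is the exponent of $G$. A sequence over $G$ is a finite multiset of elements of $G$; subsequences are sub-multisets; disjoint subsequences use distinct terms. A sequence is zero-sum if the sum of its terms is $0$; a short zero-sum sequence is a zero-sum sequence of length in $[1,\exp(G)]$. $D(G)$ is the least positive integer $k$ such that every sequence over $G$ of length at least $k$ has a nonempty zero-sum subsequence. For $r\in\mathbb{N}$, $\eta_r(G)$ is the least positive integer $k$ such that every sequence over $G$ of length at least $k$ has $r$ pairwise disjoint short zero-sum subsequences; $\eta(G)=\eta_1(G)$. -}

module Defs where

open import Level using (Level; _⊔_)
open import Algebra.Bundles using (AbelianGroup)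
open import Data.Nat using (ℕ; zero; suc; _≤_)
open import Data.Fin using (Fin; zero; suc)
open import Data.Fin.Subset using (Subset; ∣_∣; _∩_; Empty; inside; outside)
open import Data.Vec using ([]; _∷_)
open import Data.Product using (Σ; _×_; ∃)
open import Relation.Binary.PropositionalEquality using (_≢_)

module _ {c ℓ : Level} (G : AbelianGroup c ℓ) where
  open AbelianGroup G

  IsFinite : Set (c ⊔ ℓ)
  IsFinite = Σ ℕ λ n → Σ (Fin n → Carrier) λ f → ∀ x → ∃ λ i → f i ≈ x

  _·_ : ℕ → Carrier → Carrier
  zero  · g = ε
  suc m · g = g ∙ (m · g)

  IsExp : ℕ → Set (c ⊔ ℓ)
  IsExp e = 1 ≤ e × (∀ g → e · g ≈ ε)
          × (∀ m → 1 ≤ m → (∀ g → m · g ≈ ε) → e ≤ m)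

  -- A sequence of length m over G is a map Fin m → Carrier;
  -- a subsequence is given by a subset of the index set.
  subsetSum : ∀ {m} → (Fin m → Carrier) → Subset m → Carrier
  subsetSum {zero}  s []            = ε
  subsetSum {suc m} s (inside ∷ p)  = s zero ∙ subsetSum (λ i → s (suc i)) p
  subsetSum {suc m} s (outside ∷ p) = subsetSum (λ i → s (suc i)) p

  IsNonemptyZeroSum : ∀ {m} → (Fin m → Carrier) → Subset m → Set ℓ
  IsNonemptyZeroSum s p = 1 ≤ ∣ p ∣ × subsetSum s p ≈ ε

  IsShortZeroSum : ℕ → ∀ {m} → (Fin m → Carrier) → Subset m → Set ℓ
  IsShortZeroSum e s p = 1 ≤ ∣ p ∣ × ∣ p ∣ ≤ e × subsetSum s p ≈ ε

  DavenportProp : ℕ → Set (c ⊔ ℓ)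
  DavenportProp k = ∀ m → k ≤ m → (s : Fin m → Carrier) →
                    ∃ λ p → IsNonemptyZeroSum s p

  EtaProp : ℕ → ℕ → ℕ → Set (c ⊔ ℓ)
  EtaProp e r k = ∀ m → k ≤ m → (s : Fin m → Carrier) →
                  Σ (Fin r → Subset m) λ ps →
                    (∀ i → IsShortZeroSum e s (ps i)) ×
                    (∀ i j → i ≢ j → Empty (ps i ∩ ps j))

IsLeastPos : ∀ {a} → (ℕ → Set a) → ℕ → Set a
IsLeastPos P k = 1 ≤ k × P k × (∀ j → 1 ≤ j → P j → k ≤ j)

module _ {c ℓ : Level} (G : AbelianGroup c ℓ) where
  IsD : ℕ → Set (c ⊔ ℓ)
  IsD = IsLeastPos (DavenportProp G)

  IsEta : ℕ → ℕ → ℕ → Set (c ⊔ ℓ)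
  IsEta e r = IsLeastPos (EtaProp G e r)

{-# OPTIONS --safe #-}
-- Greedy extraction: a sequence of length at least D(G) + r·exp(G) is long
-- enough to contain a short zero-sum subsequence T (as η(G) ≤ D(G) + exp(G)),
-- and removing T costs at most exp(G) terms, so r − 1 further disjoint ones
-- exist in what is left, by induction on r.
module Submission where

open import Defs
open import Level using (Level)
open import Algebra.Bundles using (AbelianGroup)
open import Data.Nat using (ℕ; _≤_; _+_; _*_; zero; suc)
open import Data.Nat.Properties
  using (≤-trans; ≤-reflexive; +-assoc; +-comm; +-monoʳ-≤; m≤m+n; m≤n+m; *-mono-≤; m+n≤o⇒m≤o∸n; ∸-mono)
open import Data.Fin using (Fin; zero; suc)
open import Data.Fin.Subset using (Subset; ∣_∣; _∩_; _⊆_; ∁; Empty; inside; outside)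
open import Data.Fin.Subset.Properties
  using (⊆-refl; drop-∷-Empty; x∈p∩q⁺; x∈p∩q⁻; x∈∁p⇒x∉p; ∣∁p∣≡n∸∣p∣; ∩-comm)
open import Data.Vec using ([]; _∷_; here; there)
open import Data.Product using (Σ; _×_; _,_; proj₁; proj₂)
open import Data.Empty using (⊥-elim)
open import Function using (_∘_)
open import Relation.Binary.PropositionalEquality as ≡ using (_≡_; _≢_; cong; subst)

private
  variable
    m : ℕ
    p p′ q q′ : Subset m

∩-Empty-mono : p ⊆ p′ → q ⊆ q′ → Empty (p′ ∩ q′) → Empty (p ∩ q)
∩-Empty-mono {p = p} {q = q} p⊆p′ q⊆q′ empty (x , x∈p∩q) =
  let x∈p , x∈q = x∈p∩q⁻ p q x∈p∩q in empty (x , x∈p∩q⁺ (p⊆p′ x∈p , q⊆q′ x∈q))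

∩-Empty-comm : Empty (p ∩ q) → Empty (q ∩ p)
∩-Empty-comm {p = p} {q = q} = subst Empty (∩-comm p q)

p∩∁p-Empty : (p : Subset m) → Empty (p ∩ ∁ p)
p∩∁p-Empty p (x , x∈p∩∁p) = let x∈p , x∈∁p = x∈p∩q⁻ p (∁ p) x∈p∩∁p in x∈∁p⇒x∉p x∈∁p x∈p

lift : (A : Subset m) → Subset ∣ A ∣ → Subset m
lift []            []      = []
lift (inside ∷ A)  (b ∷ q) = b ∷ lift A q
lift (outside ∷ A) q       = outside ∷ lift A q

∣lift∣≡∣q∣ : (A : Subset m) (q : Subset ∣ A ∣) → ∣ lift A q ∣ ≡ ∣ q ∣
∣lift∣≡∣q∣ []            []           = ≡.refl
∣lift∣≡∣q∣ (inside ∷ A)  (inside ∷ q)  = cong suc (∣lift∣≡∣q∣ A q)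
∣lift∣≡∣q∣ (inside ∷ A)  (outside ∷ q) = ∣lift∣≡∣q∣ A q
∣lift∣≡∣q∣ (outside ∷ A) q             = ∣lift∣≡∣q∣ A q

lift⊆ : (A : Subset m) (q : Subset ∣ A ∣) → lift A q ⊆ A
lift⊆ (inside ∷ A)  (b ∷ q) here       = here
lift⊆ (inside ∷ A)  (b ∷ q) (there x∈) = there (lift⊆ A q x∈)
lift⊆ (outside ∷ A) q       (there x∈) = there (lift⊆ A q x∈)

lift-∩ : (A : Subset m) (q q′ : Subset ∣ A ∣) → lift A q ∩ lift A q′ ≡ lift A (q ∩ q′)
lift-∩ []            []      []        = ≡.refl
lift-∩ (inside ∷ A)  (b ∷ q) (b′ ∷ q′) = cong (_ ∷_) (lift-∩ A q q′)
lift-∩ (outside ∷ A) q       q′        = cong (outside ∷_) (lift-∩ A q q′)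

lift-Empty : (A : Subset m) {q : Subset ∣ A ∣} → Empty q → Empty (lift A q)
lift-Empty (inside ∷ A)  {inside ∷ q}  empty _                = empty (zero , here)
lift-Empty (inside ∷ A)  {outside ∷ q} empty (suc x , there x∈) =
  lift-Empty A (drop-∷-Empty empty) (x , x∈)
lift-Empty (outside ∷ A)               empty (suc x , there x∈) = lift-Empty A empty (x , x∈)

lift-Disjoint : (A : Subset m) {q q′ : Subset ∣ A ∣} →
                Empty (q ∩ q′) → Empty (lift A q ∩ lift A q′)
lift-Disjoint A {q} {q′} = subst Empty (≡.sym (lift-∩ A q q′)) ∘ lift-Empty A

module _ {c ℓ : Level} (G : AbelianGroup c ℓ) where
  open AbelianGroup G using (Carrier; _≈_; ∙-congˡ; refl; sym; trans)

  restrict : (Fin m → Carrier) → (A : Subset m) → Fin ∣ A ∣ → Carrier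
  restrict s (inside ∷ A)  zero    = s zero
  restrict s (inside ∷ A)  (suc i) = restrict (s ∘ suc) A i
  restrict s (outside ∷ A) i       = restrict (s ∘ suc) A i

  subsetSum-lift : (s : Fin m → Carrier) (A : Subset m) (q : Subset ∣ A ∣) →
                   subsetSum G (restrict s A) q ≈ subsetSum G s (lift A q)
  subsetSum-lift s []            []            = refl
  subsetSum-lift s (inside ∷ A)  (inside ∷ q)  = ∙-congˡ (subsetSum-lift (s ∘ suc) A q)
  subsetSum-lift s (inside ∷ A)  (outside ∷ q) = subsetSum-lift (s ∘ suc) A q
  subsetSum-lift s (outside ∷ A) q             = subsetSum-lift (s ∘ suc) A q

  IsShortZeroSum-lift : ∀ e (s : Fin m → Carrier) (A : Subset m) {q : Subset ∣ A ∣} →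
                        IsShortZeroSum G e (restrict s A) q → IsShortZeroSum G e s (lift A q)
  IsShortZeroSum-lift e s A {q} (1≤∣q∣ , ∣q∣≤e , Σq≈ε) =
    subst (1 ≤_) ∣q∣≡ 1≤∣q∣ , subst (_≤ e) ∣q∣≡ ∣q∣≤e , trans (sym (subsetSum-lift s A q)) Σq≈ε
    where ∣q∣≡ = ≡.sym (∣lift∣≡∣q∣ A q)

  DisjointShortZeroSums : ℕ → ℕ → (Fin m → Carrier) → Set ℓ
  DisjointShortZeroSums {m} e r s =
    Σ (Fin r → Subset m) λ ps →
      (∀ i → IsShortZeroSum G e s (ps i)) × (∀ i j → i ≢ j → Empty (ps i ∩ ps j))

  DisjointShortZeroSums-cons : ∀ e r (s : Fin m → Carrier) (T : Subset m) →
                               IsShortZeroSum G e s T →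
                               DisjointShortZeroSums e r (restrict s (∁ T)) →
                               DisjointShortZeroSums e (suc r) s
  DisjointShortZeroSums-cons e r s T T-short (qs , qs-short , qs-disjoint) = ps , ps-short , ps-disjoint
    where
    ps : Fin (suc r) → Subset _
    ps zero    = T
    ps (suc i) = lift (∁ T) (qs i)

    ps-short : ∀ i → IsShortZeroSum G e s (ps i)
    ps-short zero    = T-short
    ps-short (suc i) = IsShortZeroSum-lift e s (∁ T) (qs-short i)

    T-disjoint : ∀ i → Empty (T ∩ ps (suc i))
    T-disjoint i = ∩-Empty-mono ⊆-refl (lift⊆ (∁ T) (qs i)) (p∩∁p-Empty T)

    ps-disjoint : ∀ i j → i ≢ j → Empty (ps i ∩ ps j)
    ps-disjoint zero    zero    i≢j = ⊥-elim (i≢j ≡.refl)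
    ps-disjoint zero    (suc j) _   = T-disjoint j
    ps-disjoint (suc i) zero    _   = ∩-Empty-comm (T-disjoint i)
    ps-disjoint (suc i) (suc j) i≢j = lift-Disjoint (∁ T) (qs-disjoint i j (i≢j ∘ cong suc))

  EtaProp-mono : ∀ {e r k k′} → k ≤ k′ → EtaProp G e r k → EtaProp G e r k′
  EtaProp-mono k≤k′ η m k′≤m = η m (≤-trans k≤k′ k′≤m)

  EtaProp-suc : ∀ {e r k k′ t} → EtaProp G e 1 k → EtaProp G e r k′ →
                k ≤ t → k′ + e ≤ t → EtaProp G e (suc r) t
  EtaProp-suc {e} {r} {k′ = k′} η₁ ηr k≤t k′+e≤t m t≤m s
    with η₁ m (≤-trans k≤t t≤m) s
  ... | Ts , Ts-short , _ =
    DisjointShortZeroSums-cons e r s T (Ts-short zero) (ηr ∣ ∁ T ∣ k′≤∣∁T∣ (restrict s (∁ T)))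
    where
    T = Ts zero
    k′≤∣∁T∣ : k′ ≤ ∣ ∁ T ∣
    k′≤∣∁T∣ = subst (k′ ≤_) (≡.sym (∣∁p∣≡n∸∣p∣ T))
                (≤-trans (m+n≤o⇒m≤o∸n k′ k′+e≤t) (∸-mono t≤m (proj₁ (proj₂ (Ts-short zero)))))

  EtaProp-linear : ∀ {e k} → EtaProp G e 1 (k + e) → ∀ r → EtaProp G e r (k + r * e)
  EtaProp-linear η₁ zero    _ _ _ = (λ ()) , (λ ()) , λ ()
  EtaProp-linear {e} {k} η₁ (suc r) =
    EtaProp-suc η₁ (EtaProp-linear η₁ r) (+-monoʳ-≤ k (m≤m+n e (r * e))) (≤-reflexive k+r*e+e≡)
    where
    k+r*e+e≡ : k + r * e + e ≡ k + (e + r * e)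
    k+r*e+e≡ = ≡.trans (+-assoc k (r * e) e) (cong (k +_) (+-comm (r * e) e))

lemma11 : ∀ {c ℓ : Level} (G : AbelianGroup c ℓ) → IsFinite G →
          (r : ℕ) → 1 ≤ r →
          (e d η ηr : ℕ) → IsExp G e → IsD G d →
          IsEta G e 1 η → IsEta G e r ηr →
          η ≤ d + e → ηr ≤ d + r * e
lemma11 G _ r 1≤r e d η ηr (1≤e , _) _ (_ , η-prop , _) (_ , _ , ηr-least) η≤d+e =
  ηr-least (d + r * e) 1≤d+r*e (EtaProp-linear G (EtaProp-mono G η≤d+e η-prop) r)
  where
  1≤d+r*e : 1 ≤ d + r * e
  1≤d+r*e = ≤-trans (*-mono-≤ 1≤r 1≤e) (m≤n+m (r * e) d)
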